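{- Let $K \subseteq \mathbb{R}^n$ be a full-dimensional convex set containing a Euclidean ball of positive radius centered at the origin, and suppose that for every nonzero $c \in \mathbb{R}^n$ the maximum of $c^T x$ over $x \in K$ is attained; let $k_c \in K$ denote a maximizer. Let $p \in \mathbb{R}^n$ with $p \notin K$, let $S_n = \{c \in \mathbb{R}^n : \|c\|_2 = 1\}$, and let $M_p := \{c \in S_n : c^T k_c < c^T p\}$. Suppose $m \in M_p$ and $c \in S_n \setminus M_p$, and let $\bar{a} := (p - k_c) - \mathrm{Proj}_c(p - k_c)$, where $\mathrm{Proj}_c(v) = (c^T v)\, c$ is the orthogonal projection of $v$ onto the line spanned by the unit vector $c$. If $m^T c \geq 0$, then $m^T \bar{a} > 0$.
   Context: $\|\cdot\|_2$ is the Euclidean norm. Since $k_c$ maximizes $c^Tx$ over $K$, the condition $c^T k_c < c^T p$ means $c^T x < c^T p$ for every $x \in K$, independently of which maximizer is chosen. -}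

module Defs where

open import Data.Nat using (ℕ; zero; suc)
open import Data.Fin using (Fin; zero; suc)
open import Data.Product using (Σ; ∃; _×_; _,_)
open import Data.Sum using (_⊎_)
open import Relation.Binary.PropositionalEquality using (_≡_)
open import Relation.Nullary using (¬_)

-- All models are (classically) isomorphic to ℝ.
record RealField : Set₁ where
  infixl 6 _+_
  infixl 7 _*_
  infix 4 _<_
  field
    R : Set
    0# 1# : R
    _+_ _*_ : R → R → R
    -_ : R → R
    inv : (x : R) → ¬ (x ≡ 0#) → R
    _<_ : R → R → Set
    +-assoc : ∀ x y z → (x + y) + z ≡ x + (y + z)
    +-comm : ∀ x y → x + y ≡ y + x
    +-identityˡ : ∀ x → 0# + x ≡ x
    +-inverseˡ : ∀ x → (- x) + x ≡ 0#
    *-assoc : ∀ x y z → (x * y) * z ≡ x * (y * z)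
    *-comm : ∀ x y → x * y ≡ y * x
    *-identityˡ : ∀ x → 1# * x ≡ x
    distribˡ : ∀ x y z → x * (y + z) ≡ x * y + x * z
    inverseˡ : ∀ x (nz : ¬ (x ≡ 0#)) → inv x nz * x ≡ 1#
    0≢1 : ¬ (0# ≡ 1#)
    <-irrefl : ∀ x → ¬ (x < x)
    <-trans : ∀ {x y z} → x < y → y < z → x < z
    <-trichotomy : ∀ x y → x < y ⊎ x ≡ y ⊎ y < x
    +-mono-< : ∀ {x y} z → x < y → x + z < y + z
    *-pos : ∀ {x y} → 0# < x → 0# < y → 0# < x * y
    lub : (P : R → Set) → ∃ P → (Σ R λ b → ∀ x → P x → (x < b ⊎ x ≡ b)) →
          Σ R λ s → (∀ x → P x → (x < s ⊎ x ≡ s)) ×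
                    (∀ b → (∀ x → P x → (x < b ⊎ x ≡ b)) → (s < b ⊎ s ≡ b))

module Geometry (F : RealField) where
  open RealField F public using (R; 0#; 1#; _<_)
  open RealField F hiding (R; 0#; 1#; _<_)

  infix 4 _≤_
  _≤_ : R → R → Set
  x ≤ y = x < y ⊎ x ≡ y

  _-_ : R → R → R
  x - y = x + (- y)

  Vec : ℕ → Set
  Vec n = Fin n → R

  0ᵥ : ∀ {n} → Vec n
  0ᵥ i = 0#

  _+ᵥ_ : ∀ {n} → Vec n → Vec n → Vec n
  (u +ᵥ v) i = u i + v i

  _-ᵥ_ : ∀ {n} → Vec n → Vec n → Vec n
  (u -ᵥ v) i = u i - v i

  _·ᵥ_ : ∀ {n} → R → Vec n → Vec n
  (t ·ᵥ v) i = t * v i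

  dot : ∀ {n} → Vec n → Vec n → R
  dot {zero} u v = 0#
  dot {suc n} u v = u zero * v zero + dot {n} (λ i → u (suc i)) (λ i → v (suc i))

  Nonzero : ∀ {n} → Vec n → Set
  Nonzero c = ¬ (∀ i → c i ≡ 0ᵥ i)

  -- unit sphere Sₙ = {c : ‖c‖₂ = 1}; ‖c‖₂ = 1 iff cᵀc = 1
  Sphere : ∀ {n} → Vec n → Set
  Sphere c = dot c c ≡ 1#

  -- open Euclidean ball of radius r centred at the origin: ‖x‖₂ < r (with r > 0)
  Ball : ∀ {n} → R → Vec n → Set
  Ball r x = dot x x < r * r

  Convex : ∀ {n} → (Vec n → Set) → Set
  Convex K = ∀ x y t → K x → K y → 0# ≤ t → t ≤ 1# →
             K ((t ·ᵥ x) +ᵥ ((1# - t) ·ᵥ y))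

  Proj : ∀ {n} → Vec n → Vec n → Vec n
  Proj c v = dot c v ·ᵥ c

  IsMaximizerChoice : ∀ {n} → (Vec n → Set) → (Vec n → Vec n) → Set
  IsMaximizerChoice K k =
    ∀ c → Nonzero c → K (k c) × (∀ x → K x → dot c x ≤ dot c (k c))

  InM : ∀ {n} → (Vec n → Vec n) → Vec n → Vec n → Set
  InM k p c = Sphere c × (dot c (k c) < dot c p)

-- Expanding the projection, mᵀā = mᵀ(p − k_c) − (cᵀ(p − k_c)) (mᵀc).  The first term is
-- positive because m ∈ M_p puts p strictly above every point of K in direction m, k_c
-- included.  In the second, cᵀ(p − k_c) ≤ 0 because c ∉ M_p, and mᵀc ≥ 0 by hypothesis.
module Submission where

open import Defs
open import Level using (0ℓ)
open import Data.Nat using (ℕ; zero; suc)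
open import Data.Fin using (zero; suc)
open import Data.Product using (Σ; _×_; _,_; proj₁; proj₂)
open import Data.Sum using (inj₁; inj₂)
open import Data.Empty using (⊥-elim)
open import Function using (_∘_)
open import Relation.Nullary using (¬_)
open import Relation.Binary.PropositionalEquality
  using (_≡_; refl; sym; trans; cong; cong₂; subst; subst₂; isEquivalence; module ≡-Reasoning)
open import Algebra.Bundles using (CommutativeRing)
open import Algebra.Consequences.Propositional using (comm∧idˡ⇒id; comm∧invˡ⇒inv; comm∧distrˡ⇒distrʳ)

module RealFieldProperties (F : RealField) where
  open RealField F
  open Geometry F using (_≤_; _-_)

  commutativeRing : CommutativeRing 0ℓ 0ℓ
  commutativeRing = record
    { Carrier = R
    ; _≈_ = _≡_
    ; isCommutativeRing = record
      { isRing = record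
        { +-isAbelianGroup = record
          { isGroup = record
            { isMonoid = record
              { isSemigroup = record
                { isMagma = record { isEquivalence = isEquivalence ; ∙-cong = cong₂ _+_ }
                ; assoc = +-assoc
                }
              ; identity = comm∧idˡ⇒id +-comm +-identityˡ
              }
            ; inverse = comm∧invˡ⇒inv +-comm +-inverseˡ
            ; ⁻¹-cong = cong (λ x → - x)
            }
          ; comm = +-comm
          }
        ; *-cong = cong₂ _*_
        ; *-assoc = *-assoc
        ; *-identity = comm∧idˡ⇒id *-comm *-identityˡ
        ; distrib = distribˡ , comm∧distrˡ⇒distrʳ *-comm distribˡ
        }
      ; *-comm = *-comm
      }
    }

  open CommutativeRing commutativeRing public using (zeroˡ; zeroʳ; -‿inverseʳ)
  open CommutativeRing commutativeRing
    using (ring; +-abelianGroup; +-commutativeSemigroup; *-commutativeSemigroup)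
  open import Algebra.Properties.Ring ring public using (-‿distribˡ-*; x[y-z]≈xy-xz)
  open import Algebra.Properties.AbelianGroup +-abelianGroup public using (⁻¹-∙-comm)
  open import Algebra.Properties.CommutativeSemigroup +-commutativeSemigroup public
    using (interchange)
  open import Algebra.Properties.CommutativeSemigroup *-commutativeSemigroup public
    using (x∙yz≈y∙xz)

  ≤-<-trans : ∀ {x y z} → x ≤ y → y < z → x < z
  ≤-<-trans (inj₁ x<y) y<z = <-trans x<y y<z
  ≤-<-trans (inj₂ refl) y<z = y<z

  ≮⇒≥ : ∀ {x y} → ¬ (x < y) → y ≤ x
  ≮⇒≥ {x} {y} x≮y with <-trichotomy x y
  ... | inj₁ x<y = ⊥-elim (x≮y x<y)
  ... | inj₂ (inj₁ x≡y) = inj₂ (sym x≡y)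
  ... | inj₂ (inj₂ y<x) = inj₁ y<x

  +-monoˡ-≤ : ∀ {x y} z → x ≤ y → x + z ≤ y + z
  +-monoˡ-≤ z (inj₁ x<y) = inj₁ (+-mono-< z x<y)
  +-monoˡ-≤ z (inj₂ refl) = inj₂ refl

  x<y⇒0<y-x : ∀ {x y} → x < y → 0# < y - x
  x<y⇒0<y-x {x} x<y = subst (_< _) (-‿inverseʳ x) (+-mono-< (- x) x<y)

  x≤y⇒x-y≤0 : ∀ {x y} → x ≤ y → x - y ≤ 0#
  x≤y⇒x-y≤0 {y = y} x≤y = subst (_ ≤_) (-‿inverseʳ y) (+-monoˡ-≤ (- y) x≤y)

  x≤0⇒0≤-x : ∀ {x} → x ≤ 0# → 0# ≤ - x
  x≤0⇒0≤-x {x} x≤0 = subst₂ _≤_ (-‿inverseʳ x) (+-identityˡ (- x)) (+-monoˡ-≤ (- x) x≤0)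

  *-nonneg : ∀ {x y} → 0# ≤ x → 0# ≤ y → 0# ≤ x * y
  *-nonneg (inj₁ 0<x) (inj₁ 0<y) = inj₁ (*-pos 0<x 0<y)
  *-nonneg {x} _ (inj₂ refl) = inj₂ (sym (zeroʳ x))
  *-nonneg {y = y} (inj₂ refl) _ = inj₂ (sym (zeroˡ y))

  +-pos-nonneg : ∀ {x y} → 0# < x → 0# ≤ y → 0# < x + y
  +-pos-nonneg {x} {y} 0<x 0≤y =
    ≤-<-trans (subst (0# ≤_) (sym (+-identityˡ y)) 0≤y) (+-mono-< y 0<x)

  -- The _-_ of Defs has no fixity declaration, so it binds tighter than _*_.
  pos-sub-nonpos*nonneg : ∀ {a b c} → 0# < a → b ≤ 0# → 0# ≤ c → 0# < a - (b * c)
  pos-sub-nonpos*nonneg {a} {b} {c} 0<a b≤0 0≤c =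
    subst (0# <_) (cong (a +_) (sym (-‿distribˡ-* b c)))
      (+-pos-nonneg 0<a (*-nonneg (x≤0⇒0≤-x b≤0) 0≤c))

module GeometryProperties (F : RealField) where
  open RealField F using (_+_; _*_; -_; 0≢1; +-identityˡ; distribˡ)
  open Geometry F
  open RealFieldProperties F
  open ≡-Reasoning

  dot-zeroˡ : ∀ {n} {u v : Vec n} → (∀ i → u i ≡ 0ᵥ i) → dot u v ≡ 0#
  dot-zeroˡ {zero} u≡0 = refl
  dot-zeroˡ {suc n} {u} {v} u≡0 = begin
    u zero * v zero + dot (u ∘ suc) (v ∘ suc)
      ≡⟨ cong₂ _+_ (cong (_* v zero) (u≡0 zero)) (dot-zeroˡ (u≡0 ∘ suc)) ⟩
    0# * v zero + 0#  ≡⟨ cong (_+ 0#) (zeroˡ (v zero)) ⟩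
    0# + 0#           ≡⟨ +-identityˡ 0# ⟩
    0#                ∎

  dot-sub : ∀ {n} (u v w : Vec n) → dot u (v -ᵥ w) ≡ dot u v - dot u w
  dot-sub {zero} u v w = sym (-‿inverseʳ 0#)
  dot-sub {suc n} u v w = begin
    u zero * (v zero - w zero) + dot (u ∘ suc) ((v -ᵥ w) ∘ suc)
      ≡⟨ cong₂ _+_ (x[y-z]≈xy-xz (u zero) (v zero) (w zero)) (dot-sub (u ∘ suc) (v ∘ suc) (w ∘ suc)) ⟩
    ((u zero * v zero) - (u zero * w zero)) + (dot (u ∘ suc) (v ∘ suc) - dot (u ∘ suc) (w ∘ suc))
      ≡⟨ interchange _ _ _ _ ⟩
    (u zero * v zero + dot (u ∘ suc) (v ∘ suc)) + (- (u zero * w zero) + - dot (u ∘ suc) (w ∘ suc))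
      ≡⟨ cong (dot u v +_) (⁻¹-∙-comm _ _) ⟩
    dot u v - dot u w ∎

  dot-scaleʳ : ∀ {n} (u : Vec n) t v → dot u (t ·ᵥ v) ≡ t * dot u v
  dot-scaleʳ {zero} u t v = sym (zeroʳ t)
  dot-scaleʳ {suc n} u t v = begin
    u zero * (t * v zero) + dot (u ∘ suc) (t ·ᵥ (v ∘ suc))
      ≡⟨ cong₂ _+_ (x∙yz≈y∙xz (u zero) t (v zero)) (dot-scaleʳ (u ∘ suc) t (v ∘ suc)) ⟩
    t * (u zero * v zero) + t * dot (u ∘ suc) (v ∘ suc)
      ≡⟨ sym (distribˡ t _ _) ⟩
    t * dot u v ∎

  dot-sub-Proj : ∀ {n} (u c v : Vec n) → dot u (v -ᵥ Proj c v) ≡ dot u v - (dot c v * dot u c)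
  dot-sub-Proj u c v =
    trans (dot-sub u v (Proj c v)) (cong (λ x → dot u v - x) (dot-scaleʳ u (dot c v) c))

  sphere⇒nonzero : ∀ {n} {c : Vec n} → Sphere c → Nonzero c
  sphere⇒nonzero c∈S c≡0 = 0≢1 (trans (sym (dot-zeroˡ c≡0)) c∈S)

  InM⇒separates : ∀ {n} {K : Vec n → Set} {k p m} → IsMaximizerChoice K k → InM k p m →
                  ∀ {x} → K x → dot m x < dot m p
  InM⇒separates k-max (m∈S , m·km<m·p) x∈K =
    ≤-<-trans (proj₂ (k-max _ (sphere⇒nonzero m∈S)) _ x∈K) m·km<m·p

  ¬InM⇒≤ : ∀ {n} (k : Vec n → Vec n) p c → Sphere c → ¬ InM k p c → dot c p ≤ dot c (k c)
  ¬InM⇒≤ k p c c∈S c∉M = ≮⇒≥ (c∉M ∘ (c∈S ,_))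

lemma1 : (F : RealField) → let open Geometry F in
    (n : ℕ) (K : Vec n → Set) →
    Convex K →
    (Σ R λ r → (0# < r) × (∀ x → Ball r x → K x)) →
    (k : Vec n → Vec n) → IsMaximizerChoice K k →
    (p : Vec n) → ¬ K p →
    (m c : Vec n) → InM k p m → Sphere c → ¬ InM k p c →
    0# ≤ dot m c →
    0# < dot m ((p -ᵥ k c) -ᵥ Proj c (p -ᵥ k c))
lemma1 F n K _ _ k k-max p _ m c m∈M c∈S c∉M 0≤m·c =
  subst (0# <_) (sym (dot-sub-Proj m c (p -ᵥ k c)))
    (pos-sub-nonpos*nonneg 0<m·[p-kc] c·[p-kc]≤0 0≤m·c)
  where
  open Geometry F
  open RealFieldProperties F
  open GeometryProperties F

  kc∈K : K (k c)
  kc∈K = proj₁ (k-max c (sphere⇒nonzero c∈S))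

  0<m·[p-kc] : 0# < dot m (p -ᵥ k c)
  0<m·[p-kc] =
    subst (0# <_) (sym (dot-sub m p (k c))) (x<y⇒0<y-x (InM⇒separates k-max m∈M kc∈K))

  c·[p-kc]≤0 : dot c (p -ᵥ k c) ≤ 0#
  c·[p-kc]≤0 =
    subst (_≤ 0#) (sym (dot-sub c p (k c))) (x≤y⇒x-y≤0 (¬InM⇒≤ k p c c∈S c∉M))
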